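{- Let $m\ge3$, let $a,b\in\mathbb{Z}_m\setminus\{0,m/2\}$ with $a=b$ or $a=-b$, and suppose the $I$-graph $G=I(m;a,b)$ is connected. Then $G$ contains a $2$-hooked Hamilton cycle.
   Context: The $I$-graph $I(m;a,b)$ has vertices $u_i,v_i$ ($i\in\mathbb{Z}_m$) and edges $u_iu_{i+a}$ (outer edges), $v_iv_{i+b}$ (inner edges) and $u_iv_i$ (spokes), $i\in\mathbb{Z}_m$. A Hamilton cycle $C$ alternates between maximal paths of outer edges and maximal paths of inner edges joined by spokes; $C$ is alternating if all these rim paths have exactly one edge (equivalently, $C$ contains all spokes), and non-alternating otherwise. For $t\in\mathbb{Z}_m$, re-indexing by $t$ means renaming each $u_i,v_i$ as $u_{i+t},v_{i+t}$ (an automorphism of the graph). We say $C$ provides a Hamilton path $P$ if $P$ can be obtained from $C$ by replacing one or more edges of $C$ by edges of the graph not in $C$. A non-alternating Hamilton cycle $C$ is $2$-hooked if, for some labeling of the vertices (re-indexing by some $t$), $C$ provides a Hamilton path from $v_0$ to $v_a$ or a Hamilton path from $u_0$ to $u_b$. -}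

module Defs where

open import Level using (0ℓ)
open import Data.Nat using (ℕ; zero; suc; _+_; _*_; _≤_; NonZero)
open import Data.Nat.DivMod using (_mod_)
open import Data.Fin using (Fin; toℕ)
open import Data.Product using (Σ; ∃; ∃-syntax; _×_; _,_)
open import Data.Sum using (_⊎_)
open import Relation.Nullary using (¬_)
open import Relation.Binary.PropositionalEquality using (_≡_)
open import Relation.Binary.Construct.Closure.ReflexiveTransitive using (Star)
open import Function.Bundles using (_⇔_)

-- The I-graph I(m; a, b).  Elements of Z_m are represented by Fin m,
-- and i + a in Z_m is (toℕ i + toℕ a) mod m.
module IGraph (m : ℕ) {{nz : NonZero m}} (a b : Fin m) where

  data Vertex : Set where
    u : Fin m → Vertex
    v : Fin m → Vertex

  _⊕_ : Fin m → Fin m → Fin m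
  i ⊕ t = (toℕ i + toℕ t) mod m

  𝟘 : Fin m
  𝟘 = 0 mod m

  Adj : Vertex → Vertex → Set
  Adj (u i) (u j) = (j ≡ i ⊕ a) ⊎ (i ≡ j ⊕ a)
  Adj (v i) (v j) = (j ≡ i ⊕ b) ⊎ (i ≡ j ⊕ b)
  Adj (u i) (v j) = i ≡ j
  Adj (v i) (u j) = i ≡ j

  Connected : Set
  Connected = ∀ x y → Star Adj x y

  N : ℕ
  N = m + m

  CycSucc : Fin N → Fin N → Set
  CycSucc i j = (toℕ j ≡ suc (toℕ i)) ⊎ ((toℕ j ≡ 0) × (suc (toℕ i) ≡ N))

  LinSucc : Fin N → Fin N → Set
  LinSucc i j = toℕ j ≡ suc (toℕ i)

  -- A Hamilton cycle: a cyclic ordering c_0, ..., c_{N-1} of all vertices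
  -- (injective, hence bijective since |V| = N) with cyclically consecutive
  -- vertices adjacent.
  record HamCycle : Set where
    field
      seq   : Fin N → Vertex
      inj   : ∀ i j → seq i ≡ seq j → i ≡ j
      adj   : ∀ i j → CycSucc i j → Adj (seq i) (seq j)

  CEdge : HamCycle → Vertex → Vertex → Set
  CEdge C x y = ∃[ i ] ∃[ j ] (CycSucc i j ×
                 (((seq i ≡ x) × (seq j ≡ y)) ⊎ ((seq i ≡ y) × (seq j ≡ x))))
    where open HamCycle C

  Alternating : HamCycle → Set
  Alternating C = ∀ i → CEdge C (u i) (v i)

  NonAlternating : HamCycle → Set
  NonAlternating C = ¬ Alternating C

  record HamPath (x y : Vertex) : Set where
    field
      seq   : Fin N → Vertex
      inj   : ∀ i j → seq i ≡ seq j → i ≡ j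
      adj   : ∀ i j → LinSucc i j → Adj (seq i) (seq j)
      start : ∀ i → toℕ i ≡ 0 → seq i ≡ x
      end   : ∀ i → suc (toℕ i) ≡ N → seq i ≡ y

  PEdge : ∀ {x y} → HamPath x y → Vertex → Vertex → Set
  PEdge P x' y' = ∃[ i ] ∃[ j ] (LinSucc i j ×
                 (((seq i ≡ x') × (seq j ≡ y')) ⊎ ((seq i ≡ y') × (seq j ≡ x'))))
    where open HamPath P

  Provides : (Vertex → Vertex → Set) → ∀ {x y} → HamPath x y → Set₁
  Provides EC P =
    Σ (Vertex → Vertex → Set) λ R → Σ (Vertex → Vertex → Set) λ A →
      (∀ x y → R x y → EC x y) ×
      (∃[ x ] ∃[ y ] R x y) ×
      (∀ x y → A x y → Adj x y × ¬ EC x y) ×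
      (∀ x y → PEdge P x y ⇔ ((EC x y × ¬ R x y) ⊎ A x y))

  shift : Fin m → Vertex → Vertex
  shift t (u i) = u (i ⊕ t)
  shift t (v i) = v (i ⊕ t)

  ReEdge : HamCycle → Fin m → Vertex → Vertex → Set
  ReEdge C t x y = ∃[ x₀ ] ∃[ y₀ ] (CEdge C x₀ y₀ × (shift t x₀ ≡ x) × (shift t y₀ ≡ y))

  TwoHooked : HamCycle → Set₁
  TwoHooked C = NonAlternating C ×
    (∃[ t ] ((Σ (HamPath (v 𝟘) (v a)) λ P → Provides (ReEdge C t) P) ⊎
             (Σ (HamPath (u 𝟘) (u b)) λ P → Provides (ReEdge C t) P)))

{-# OPTIONS --safe #-}
module Submission where

-- Connectivity forces gcd(m, a) = 1: a common divisor of m, a and b = ±a divides the index of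
-- every vertex reachable from u₀, in particular of u₁.  Hence k ↦ k·a is injective on ℤ_m and,
-- as b = ±a, both rims are single m-cycles through the multiples of a, which gives the Hamilton
-- cycle v₀ u₀ u_a … u_{(m-1)a} v_{(m-1)a} … v_a.  For m ≥ 3 it avoids the spoke u_a v_a, so it is
-- non-alternating, and deleting its edge v_a v₀ leaves a Hamilton path from v₀ to v_a that it
-- provides without re-indexing (t = 0).

open import Data.Empty using (⊥; ⊥-elim)
open import Data.Fin using (Fin; toℕ; fromℕ)
open import Data.Fin.Patterns using (0F; 2F)
open import Data.Fin.Properties using (toℕ-injective; toℕ-fromℕ; toℕ-fromℕ<; fromℕ<-cong; toℕ<n)
open import Data.Nat using (ℕ; suc; zero; _+_; _*_; _∸_; _%_; _≤_; _<_; s≤s; z≤n; z<s; s<s⁻¹; NonZero; >-nonZero⁻¹)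
open import Data.Nat.Coprimality using (Coprime; coprime-divisor)
open import Data.Nat.DivMod using (_mod_; _/_; m≡m%n+[m/n]*n; m<n⇒m%n≡m; %-distribˡ-+; m%n%n≡m%n; m%n<n; [m+n]%n≡m%n)
open import Data.Nat.Divisibility using (_∣_; divides; n∣m⇒m%n≡0; n∣m*n; ∣m+n∣m⇒∣n; ∣m∣n⇒∣m+n; %-presˡ-∣; ∣n∣m%n⇒∣m; ∣1⇒≡1; _∣0)
open import Data.Nat.Properties
open import Data.Product using (Σ; _×_; _,_; proj₁; proj₂)
open import Data.Product.Function.NonDependent.Propositional using (_×-⇔_)
open import Data.Sum using (_⊎_; inj₁; inj₂)
open import Data.Sum.Function.Propositional using (_⊎-⇔_)
open import Function using (_∘_; flip)
open import Function.Bundles using (_⇔_; mk⇔; Equivalence)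
open import Function.Properties.Equivalence using () renaming (refl to ⇔-refl; trans to ⇔-trans)
open import Relation.Binary.Construct.Closure.ReflexiveTransitive using (Star; ε; _◅_)
open import Relation.Binary.PropositionalEquality using (_≡_; _≢_; refl; sym; trans; cong; subst; subst₂; module ≡-Reasoning)
open import Relation.Nullary using (¬_; yes; no; contradiction)

open import Defs

open ≡-Reasoning

module Modular {m : ℕ} {{_ : NonZero m}} where

  toℕ-mod : ∀ x → toℕ (x mod m) ≡ x % m
  toℕ-mod x = toℕ-fromℕ< (m%n<n x m)

  mod-cong : ∀ {x y} → x % m ≡ y % m → x mod m ≡ y mod m
  mod-cong {x} {y} eq = fromℕ<-cong (x % m) (y % m) eq (m%n<n x m) (m%n<n y m)

  [x%m+y]%m≡[x+y]%m : ∀ x y → (x % m + y) % m ≡ (x + y) % m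
  [x%m+y]%m≡[x+y]%m x y = begin
    (x % m + y) % m           ≡⟨ %-distribˡ-+ (x % m) y m ⟩
    (x % m % m + y % m) % m   ≡⟨ cong (λ r → (r + y % m) % m) (m%n%n≡m%n x m) ⟩
    (x % m + y % m) % m       ≡⟨ %-distribˡ-+ x y m ⟨
    (x + y) % m               ∎

  [x+y]%m≡x%m⇒m∣y : ∀ x y → (x + y) % m ≡ x % m → m ∣ y
  [x+y]%m≡x%m⇒m∣y x y eq =
    ∣m+n∣m⇒∣n (divides ((x + y) / m) (+-cancelˡ-≡ (x % m) _ _ shifted)) (n∣m*n (x / m))
    where
    shifted : x % m + (x / m * m + y) ≡ x % m + (x + y) / m * m
    shifted = begin
      x % m + (x / m * m + y)      ≡⟨ +-assoc (x % m) _ y ⟨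
      x % m + x / m * m + y        ≡⟨ cong (_+ y) (m≡m%n+[m/n]*n x m) ⟨
      x + y                        ≡⟨ m≡m%n+[m/n]*n (x + y) m ⟩
      (x + y) % m + (x + y) / m * m ≡⟨ cong (_+ (x + y) / m * m) eq ⟩
      x % m + (x + y) / m * m      ∎

  private
    *-cancelʳ-%-coprime-≤ : ∀ {c i j} → Coprime m c → i ≤ j → j < m → i * c % m ≡ j * c % m → i ≡ j
    *-cancelʳ-%-coprime-≤ {c} {i} {j} coprime i≤j j<m eq = begin
      i           ≡⟨ +-identityʳ i ⟨
      i + 0       ≡⟨ cong (i +_) d≡0 ⟨
      i + (j ∸ i) ≡⟨ m+[n∸m]≡n i≤j ⟩
      j           ∎
      where
      d = j ∸ i
      j*c≡i*c+d*c : j * c ≡ i * c + d * c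
      j*c≡i*c+d*c = trans (cong (_* c) (sym (m+[n∸m]≡n i≤j))) (*-distribʳ-+ c i d)
      m∣c*d : m ∣ c * d
      m∣c*d = subst (m ∣_) (*-comm d c)
        ([x+y]%m≡x%m⇒m∣y (i * c) (d * c) (trans (cong (_% m) (sym j*c≡i*c+d*c)) (sym eq)))
      d≡0 : d ≡ 0
      d≡0 = trans (sym (m<n⇒m%n≡m (≤-<-trans (m∸n≤m j i) j<m)))
                  (n∣m⇒m%n≡0 d m (coprime-divisor coprime m∣c*d))

  *-cancelʳ-%-coprime : ∀ {c i j} → Coprime m c → i < m → j < m → i * c % m ≡ j * c % m → i ≡ j
  *-cancelʳ-%-coprime {i = i} {j} coprime i<m j<m eq with ≤-total i j
  ... | inj₁ i≤j = *-cancelʳ-%-coprime-≤ coprime i≤j j<m eq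
  ... | inj₂ j≤i = sym (*-cancelʳ-%-coprime-≤ coprime j≤i i<m (sym eq))

module IGraphProperties {m : ℕ} {{_ : NonZero m}} (a b : Fin m) where
  open IGraph m a b
  open Modular

  toℕ-𝟘 : toℕ 𝟘 ≡ 0
  toℕ-𝟘 = trans (toℕ-mod 0) (m<n⇒m%n≡m (>-nonZero⁻¹ m))

  ⊕-identityʳ : ∀ i → i ⊕ 𝟘 ≡ i
  ⊕-identityʳ i = toℕ-injective (begin
    toℕ (i ⊕ 𝟘)           ≡⟨ toℕ-mod _ ⟩
    (toℕ i + toℕ 𝟘) % m   ≡⟨ cong (λ z → (toℕ i + z) % m) toℕ-𝟘 ⟩
    (toℕ i + 0) % m       ≡⟨ cong (_% m) (+-identityʳ (toℕ i)) ⟩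
    toℕ i % m             ≡⟨ m<n⇒m%n≡m (toℕ<n i) ⟩
    toℕ i                 ∎)

  mod-⊕ : ∀ x c → (x mod m) ⊕ c ≡ (x + toℕ c) mod m
  mod-⊕ x c = mod-cong (begin
    (toℕ (x mod m) + toℕ c) % m ≡⟨ cong (λ z → (z + toℕ c) % m) (toℕ-mod x) ⟩
    (x % m + toℕ c) % m         ≡⟨ [x%m+y]%m≡[x+y]%m x (toℕ c) ⟩
    (x + toℕ c) % m             ∎)

  shift-𝟘 : ∀ x → shift 𝟘 x ≡ x
  shift-𝟘 (u i) = cong u (⊕-identityʳ i)
  shift-𝟘 (v i) = cong v (⊕-identityʳ i)

  multiple : ℕ → Fin m
  multiple k = (k * toℕ a) mod m

  multiple-1 : multiple 1 ≡ a
  multiple-1 = toℕ-injective (begin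
    toℕ (multiple 1)    ≡⟨ toℕ-mod (1 * toℕ a) ⟩
    (1 * toℕ a) % m     ≡⟨ cong (_% m) (*-identityˡ (toℕ a)) ⟩
    toℕ a % m           ≡⟨ m<n⇒m%n≡m (toℕ<n a) ⟩
    toℕ a               ∎)

  multiple-suc : ∀ k → multiple (suc k) ≡ multiple k ⊕ a
  multiple-suc k = begin
    (toℕ a + k * toℕ a) mod m ≡⟨ cong (_mod m) (+-comm (toℕ a) (k * toℕ a)) ⟩
    (k * toℕ a + toℕ a) mod m ≡⟨ mod-⊕ (k * toℕ a) a ⟨
    multiple k ⊕ a            ∎

  multiple-injective : Coprime m (toℕ a) → ∀ {i j} → i < m → j < m → multiple i ≡ multiple j → i ≡ j
  multiple-injective coprime {i} {j} i<m j<m eq =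
    *-cancelʳ-%-coprime coprime i<m j<m
      (trans (sym (toℕ-mod (i * toℕ a))) (trans (cong toℕ eq) (toℕ-mod (j * toℕ a))))

  outer-multiple : ∀ k → Adj (u (multiple k)) (u (multiple (suc k)))
  outer-multiple k = inj₁ (multiple-suc k)

  inner-multiple : a ≡ b ⊎ toℕ a + toℕ b ≡ m → ∀ k → Adj (v (multiple (suc k))) (v (multiple k))
  inner-multiple (inj₁ refl) k = inj₂ (multiple-suc k)
  inner-multiple (inj₂ a+b≡m) k = inj₁ (sym (begin
    multiple (suc k) ⊕ b                 ≡⟨ mod-⊕ (suc k * toℕ a) b ⟩
    (toℕ a + k * toℕ a + toℕ b) mod m    ≡⟨ cong (λ z → (z + toℕ b) mod m) (+-comm (toℕ a) (k * toℕ a)) ⟩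
    (k * toℕ a + toℕ a + toℕ b) mod m    ≡⟨ cong (_mod m) (+-assoc (k * toℕ a) (toℕ a) (toℕ b)) ⟩
    (k * toℕ a + (toℕ a + toℕ b)) mod m  ≡⟨ cong (λ z → (k * toℕ a + z) mod m) a+b≡m ⟩
    (k * toℕ a + m) mod m                ≡⟨ mod-cong ([m+n]%n≡m%n (k * toℕ a) m) ⟩
    multiple k                           ∎))

  index : Vertex → Fin m
  index (u i) = i
  index (v i) = i

  module _ {d : ℕ} (d∣m : d ∣ m) where

    Divisible : Fin m → Set
    Divisible i = d ∣ toℕ i

    ⊕-pres-Divisible : ∀ {i c} → Divisible i → Divisible c → Divisible (i ⊕ c)
    ⊕-pres-Divisible {i} {c} d∣i d∣c =
      subst (d ∣_) (sym (toℕ-mod (toℕ i + toℕ c))) (%-presˡ-∣ (∣m∣n⇒∣m+n d∣i d∣c) d∣m)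

    ⊕-reflects-Divisible : ∀ {i c} → Divisible c → Divisible (i ⊕ c) → Divisible i
    ⊕-reflects-Divisible {i} {c} d∣c d∣i⊕c = ∣m+n∣m⇒∣n
      (subst (d ∣_) (+-comm (toℕ i) (toℕ c)) (∣n∣m%n⇒∣m d∣m (subst (d ∣_) (toℕ-mod (toℕ i + toℕ c)) d∣i⊕c)))
      d∣c

    module _ (d∣a : d ∣ toℕ a) (d∣b : d ∣ toℕ b) where

      Adj-pres-Divisible : ∀ {x y} → Adj x y → Divisible (index x) → Divisible (index y)
      Adj-pres-Divisible {u i} {u j} (inj₁ j≡i⊕a) d∣i = subst Divisible (sym j≡i⊕a) (⊕-pres-Divisible d∣i d∣a)
      Adj-pres-Divisible {u i} {u j} (inj₂ i≡j⊕a) d∣i = ⊕-reflects-Divisible d∣a (subst Divisible i≡j⊕a d∣i)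
      Adj-pres-Divisible {v i} {v j} (inj₁ j≡i⊕b) d∣i = subst Divisible (sym j≡i⊕b) (⊕-pres-Divisible d∣i d∣b)
      Adj-pres-Divisible {v i} {v j} (inj₂ i≡j⊕b) d∣i = ⊕-reflects-Divisible d∣b (subst Divisible i≡j⊕b d∣i)
      Adj-pres-Divisible {u i} {v j} i≡j d∣i = subst Divisible i≡j d∣i
      Adj-pres-Divisible {v i} {u j} i≡j d∣i = subst Divisible i≡j d∣i

      Star-pres-Divisible : ∀ {x y} → Star Adj x y → Divisible (index x) → Divisible (index y)
      Star-pres-Divisible ε d∣x = d∣x
      Star-pres-Divisible (e ◅ es) d∣x = Star-pres-Divisible es (Adj-pres-Divisible e d∣x)

  connected⇒gcd≡1 : 1 < m → Connected → ∀ {d} → d ∣ m → d ∣ toℕ a → d ∣ toℕ b → d ≡ 1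
  connected⇒gcd≡1 1<m connected {d} d∣m d∣a d∣b = ∣1⇒≡1 (subst (d ∣_) toℕ-1 d∣1modm)
    where
    toℕ-1 : toℕ (1 mod m) ≡ 1
    toℕ-1 = trans (toℕ-mod 1) (m<n⇒m%n≡m 1<m)
    d∣1modm : d ∣ toℕ (1 mod m)
    d∣1modm = Star-pres-Divisible d∣m d∣a d∣b (connected (u 𝟘) (u (1 mod m)))
                                  (subst (d ∣_) (sym toℕ-𝟘) (d ∣0))

  a±b⇒∣b : a ≡ b ⊎ toℕ a + toℕ b ≡ m → ∀ {d} → d ∣ m → d ∣ toℕ a → d ∣ toℕ b
  a±b⇒∣b (inj₁ refl) d∣m d∣a = d∣a
  a±b⇒∣b (inj₂ a+b≡m) d∣m d∣a = ∣m+n∣m⇒∣n (subst (_ ∣_) (sym a+b≡m) d∣m) d∣a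

  SameEdge : Vertex → Vertex → Vertex → Vertex → Set
  SameEdge s t x y = (s ≡ x × t ≡ y) ⊎ (s ≡ y × t ≡ x)

  SameEdge-trans : ∀ {s t s′ t′ x y} → SameEdge s t x y → SameEdge s′ t′ x y → SameEdge s t s′ t′
  SameEdge-trans (inj₁ (refl , refl)) (inj₁ (refl , refl)) = inj₁ (refl , refl)
  SameEdge-trans (inj₁ (refl , refl)) (inj₂ (refl , refl)) = inj₂ (refl , refl)
  SameEdge-trans (inj₂ (refl , refl)) (inj₁ (refl , refl)) = inj₂ (refl , refl)
  SameEdge-trans (inj₂ (refl , refl)) (inj₂ (refl , refl)) = inj₁ (refl , refl)

  mkHamCycle : (f : ℕ → Vertex) →
               (∀ {i j} → i < N → j < N → f i ≡ f j → i ≡ j) →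
               (∀ {i} → suc i < N → Adj (f i) (f (suc i))) →
               (∀ {i} → suc i ≡ N → Adj (f i) (f 0)) →
               HamCycle
  mkHamCycle f injective step close = record
    { seq = λ i → f (toℕ i)
    ; inj = λ i j eq → toℕ-injective (injective (toℕ<n i) (toℕ<n j) eq)
    ; adj = adjacent
    }
    where
    adjacent : ∀ i j → CycSucc i j → Adj (f (toℕ i)) (f (toℕ j))
    adjacent i j (inj₁ j≡1+i) = subst (Adj (f (toℕ i)) ∘ f) (sym j≡1+i) (step (subst (_< N) j≡1+i (toℕ<n j)))
    adjacent i j (inj₂ (j≡0 , 1+i≡N)) = subst (Adj (f (toℕ i)) ∘ f) (sym j≡0) (close 1+i≡N)

  module _ (C : HamCycle) where
    open HamCycle C

    CEdge⇒CycSucc : ∀ {i j} → CEdge C (seq i) (seq j) → CycSucc i j ⊎ CycSucc j i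
    CEdge⇒CycSucc (i′ , j′ , s , inj₁ (p , q)) = inj₁ (subst₂ CycSucc (inj _ _ p) (inj _ _ q) s)
    CEdge⇒CycSucc (i′ , j′ , s , inj₂ (p , q)) = inj₂ (subst₂ CycSucc (inj _ _ p) (inj _ _ q) s)

    module _ (2<N : 2 < N) (first last : Fin N)
             (first≡0 : toℕ first ≡ 0) (1+last≡N : suc (toℕ last) ≡ N) where

      openedPath : HamPath (seq first) (seq last)
      openedPath = record
        { seq   = seq
        ; inj   = inj
        ; adj   = λ i j s → adj i j (inj₁ s)
        ; start = λ i i≡0 → cong seq (toℕ-injective (trans i≡0 (sym first≡0)))
        ; end   = λ i 1+i≡N → cong seq (toℕ-injective (suc-injective (trans 1+i≡N (sym 1+last≡N))))
        }

      ClosingEdge : Vertex → Vertex → Set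
      ClosingEdge = SameEdge (seq last) (seq first)

      LinSucc⇒¬ClosingEdge : ∀ {i j} → LinSucc i j → ¬ ClosingEdge (seq i) (seq j)
      LinSucc⇒¬ClosingEdge {i} {j} j≡1+i (inj₁ (_ , first↦j)) with () ← begin
        suc (toℕ i) ≡⟨ j≡1+i ⟨
        toℕ j       ≡⟨ cong toℕ (inj _ _ first↦j) ⟨
        toℕ first   ≡⟨ first≡0 ⟩
        0           ∎
      LinSucc⇒¬ClosingEdge {i} {j} j≡1+i (inj₂ (last↦j , first↦i)) = <-irrefl (sym N≡2) 2<N
        where
        N≡2 : N ≡ 2
        N≡2 = begin
          N                     ≡⟨ 1+last≡N ⟨
          suc (toℕ last)        ≡⟨ cong (suc ∘ toℕ) (inj _ _ last↦j) ⟩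
          suc (toℕ j)           ≡⟨ cong suc j≡1+i ⟩
          suc (suc (toℕ i))     ≡⟨ cong (suc ∘ suc ∘ toℕ) (inj _ _ first↦i) ⟨
          suc (suc (toℕ first)) ≡⟨ cong (suc ∘ suc) first≡0 ⟩
          2                     ∎

      provides-openedPath : Provides (CEdge C) openedPath
      provides-openedPath =
          ClosingEdge , (λ _ _ → ⊥)
        , (λ x y e → last , first , inj₂ (first≡0 , 1+last≡N) , e)
        , (seq last , seq first , inj₁ (refl , refl))
        , (λ _ _ ())
        , λ x y → mk⇔ pathEdge⇒ ⇒pathEdge
        where
        pathEdge⇒ : ∀ {x y} → PEdge openedPath x y → (CEdge C x y × ¬ ClosingEdge x y) ⊎ ⊥
        pathEdge⇒ (i , j , s , e) = inj₁ ((i , j , inj₁ s , e) , LinSucc⇒¬ClosingEdge s ∘ flip SameEdge-trans e)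
        ⇒pathEdge : ∀ {x y} → (CEdge C x y × ¬ ClosingEdge x y) ⊎ ⊥ → PEdge openedPath x y
        ⇒pathEdge (inj₁ ((i , j , inj₁ s , e) , _)) = i , j , s , e
        ⇒pathEdge {x} {y} (inj₁ ((i , j , inj₂ (j≡0 , 1+i≡N) , e) , ¬closing)) = ⊥-elim (¬closing
          (subst₂ (λ s t → SameEdge (seq s) (seq t) x y)
                  (toℕ-injective (suc-injective (trans 1+i≡N (sym 1+last≡N))))
                  (toℕ-injective (trans j≡0 (sym first≡0)))
                  e))

  Provides-resp-⇔ : ∀ {E E′ : Vertex → Vertex → Set} {x y} {P : HamPath x y} →
                    (∀ x y → E x y ⇔ E′ x y) → Provides E P → Provides E′ P
  Provides-resp-⇔ E⇔E′ (R , A , R⊆E , R≠∅ , A-new , P≡) =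
      R , A
    , (λ x y r → Equivalence.to (E⇔E′ x y) (R⊆E x y r))
    , R≠∅
    , (λ x y α → proj₁ (A-new x y α) , proj₂ (A-new x y α) ∘ Equivalence.from (E⇔E′ x y))
    , λ x y → ⇔-trans (P≡ x y) ((E⇔E′ x y ×-⇔ ⇔-refl) ⊎-⇔ ⇔-refl)

  CEdge⇔ReEdge-𝟘 : ∀ C x y → CEdge C x y ⇔ ReEdge C 𝟘 x y
  CEdge⇔ReEdge-𝟘 C x y = mk⇔
    (λ e → x , y , e , shift-𝟘 x , shift-𝟘 y)
    (λ (x₀ , y₀ , e , x₀↦x , y₀↦y) →
       subst₂ (CEdge C) (trans (sym (shift-𝟘 x₀)) x₀↦x) (trans (sym (shift-𝟘 y₀)) y₀↦y) e)

module HookedCycle (n : ℕ) (a b : Fin (3 + n)) (a±b : a ≡ b ⊎ toℕ a + toℕ b ≡ 3 + n)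
                   (connected : IGraph.Connected (3 + n) a b) where
  open IGraph (3 + n) a b
  open IGraphProperties a b

  m : ℕ
  m = 3 + n

  coprime : Coprime m (toℕ a)
  coprime (d∣m , d∣a) = connected⇒gcd≡1 (s≤s (s≤s z≤n)) connected d∣m d∣a (a±b⇒∣b a±b d∣m d∣a)

  blocks : ℕ → Vertex
  blocks i with i <? m
  ... | yes _ = u (multiple i)
  ... | no  _ = v (multiple (m ∸ suc (i ∸ m)))

  blocks-lower : ∀ {i} → i < m → blocks i ≡ u (multiple i)
  blocks-lower {i} i<m with i <? m
  ... | yes _   = refl
  ... | no  i≮m = contradiction i<m i≮m

  blocks-upper : ∀ k → blocks (k + m) ≡ v (multiple (m ∸ suc k))
  blocks-upper k with k + m <? m
  ... | yes k+m<m = contradiction k+m<m (≤⇒≯ (m≤n+m m k))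
  ... | no  _     = cong (λ i → v (multiple (m ∸ suc i))) (m+n∸n≡m k m)

  data Half : ℕ → Set where
    lower : ∀ {i} → i < m → Half i
    upper : ∀ k → Half (k + m)

  half : ∀ i → Half i
  half i with i <? m
  ... | yes i<m = lower i<m
  ... | no  i≮m = subst Half (m∸n+n≡m (≮⇒≥ i≮m)) (upper (i ∸ m))

  blocks-injective : ∀ {i j} → i < N → j < N → blocks i ≡ blocks j → i ≡ j
  blocks-injective {i} {j} i<N j<N eq with half i | half j
  ... | lower i<m | lower j<m =
    multiple-injective coprime i<m j<m (cong index (trans (sym (blocks-lower i<m)) (trans eq (blocks-lower j<m))))
  ... | lower i<m | upper l with () ← trans (sym (blocks-lower i<m)) (trans eq (blocks-upper l))
  ... | upper k | lower j<m with () ← trans (sym (blocks-upper k)) (trans eq (blocks-lower j<m))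
  ... | upper k | upper l = cong (_+ m) (suc-injective (∸-cancelˡ-≡ k<m l<m m∸1+k≡m∸1+l))
    where
    k<m : k < m
    k<m = +-cancelʳ-< m k m i<N
    l<m : l < m
    l<m = +-cancelʳ-< m l m j<N
    m∸1+k≡m∸1+l : m ∸ suc k ≡ m ∸ suc l
    m∸1+k≡m∸1+l = multiple-injective coprime (∸-monoʳ-< z<s k<m) (∸-monoʳ-< z<s l<m)
      (cong index (trans (sym (blocks-upper k)) (trans eq (blocks-upper l))))

  blocks-upper-adjacent : ∀ {k} → suc k < m → Adj (blocks (k + m)) (blocks (suc k + m))
  blocks-upper-adjacent {k} 1+k<m = subst₂ Adj (sym (blocks-upper k)) (sym (blocks-upper (suc k)))
    (subst (λ j → Adj (v (multiple j)) (v (multiple (m ∸ suc (suc k)))))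
           (sym (+-∸-assoc 1 1+k<m))
           (inner-multiple a±b (m ∸ suc (suc k))))

  blocks-adjacent : ∀ {i} → suc i < N → Adj (blocks i) (blocks (suc i))
  blocks-adjacent {i} 1+i<N with half i
  ... | upper k = blocks-upper-adjacent (+-cancelʳ-< m (suc k) m 1+i<N)
  ... | lower i<m with m≤n⇒m<n∨m≡n i<m
  ...   | inj₁ 1+i<m = subst₂ Adj (sym (blocks-lower i<m)) (sym (blocks-lower 1+i<m)) (outer-multiple i)
  ...   | inj₂ refl  = subst₂ Adj (sym (blocks-lower i<m)) (sym (blocks-upper 0)) refl

  blocks-last : blocks (suc (suc n) + m) ≡ v 𝟘
  blocks-last = trans (blocks-upper (suc (suc n))) (cong (v ∘ multiple) (n∸n≡0 n))

  blocks-penultimate : blocks (suc n + m) ≡ v (multiple 1)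
  blocks-penultimate = trans (blocks-upper (suc n)) (cong (v ∘ multiple) (m+n∸n≡m 1 n))

  route : ℕ → Vertex
  route zero    = v 𝟘
  route (suc i) = blocks i

  blocks≢v𝟘 : ∀ {j} → j < suc (suc n) + m → blocks j ≢ v 𝟘
  blocks≢v𝟘 j<L eq = <-irrefl (blocks-injective (m<n⇒m<1+n j<L) (n<1+n _) (trans eq (sym blocks-last))) j<L

  route-injective : ∀ {i j} → i < N → j < N → route i ≡ route j → i ≡ j
  route-injective {zero}  {zero}  _     _     _  = refl
  route-injective {zero}  {suc j} _     1+j<N eq = ⊥-elim (blocks≢v𝟘 (s<s⁻¹ 1+j<N) (sym eq))
  route-injective {suc i} {zero}  1+i<N _     eq = ⊥-elim (blocks≢v𝟘 (s<s⁻¹ 1+i<N) eq)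
  route-injective {suc i} {suc j} 1+i<N 1+j<N eq =
    cong suc (blocks-injective (<-trans (n<1+n i) 1+i<N) (<-trans (n<1+n j) 1+j<N) eq)

  route-adjacent : ∀ {i} → suc i < N → Adj (route i) (route (suc i))
  route-adjacent {zero}  _     = subst (Adj (v 𝟘)) (sym (blocks-lower z<s)) refl
  route-adjacent {suc i} 2+i<N = blocks-adjacent (<-trans (n<1+n (suc i)) 2+i<N)

  route-closing : ∀ {i} → suc i ≡ N → Adj (route i) (route 0)
  route-closing refl = subst (λ x → Adj x (v 𝟘)) (sym blocks-penultimate) (inner-multiple a±b 0)

  C : HamCycle
  C = mkHamCycle route route-injective route-adjacent route-closing

  open HamCycle C using (seq)

  last : Fin N
  last = fromℕ (suc (suc (n + m)))

  seq-2 : seq 2F ≡ u a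
  seq-2 = trans (blocks-lower (s≤s (s≤s z≤n))) (cong u multiple-1)

  seq-last : seq last ≡ v a
  seq-last = trans (cong route (toℕ-fromℕ _)) (trans blocks-penultimate (cong v multiple-1))

  -- u_a and v_a sit at positions 2 and N - 1, which are cyclically adjacent only when m ≤ 2.
  nonAlternating : NonAlternating C
  nonAlternating alternating
    with CEdge⇒CycSucc C {2F} {last} (subst₂ (CEdge C) (sym seq-2) (sym seq-last) (alternating a))
  ... | inj₁ (inj₁ last≡3) = contradiction (subst (m ≤_) n+m≡1 (m≤n+m m n)) λ { (s≤s ()) }
    where
    n+m≡1 : n + m ≡ 1
    n+m≡1 = trans (sym (toℕ-fromℕ (n + m))) (suc-injective (suc-injective last≡3))
  ... | inj₁ (inj₂ (() , _))
  ... | inj₂ (inj₁ ())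
  ... | inj₂ (inj₂ (() , _))

  hookPath : Σ (HamPath (v 𝟘) (v a)) (Provides (ReEdge C 𝟘))
  hookPath = subst (λ y → Σ (HamPath (v 𝟘) y) (Provides (ReEdge C 𝟘))) seq-last
    (P , Provides-resp-⇔ {P = P} (CEdge⇔ReEdge-𝟘 C) (provides-openedPath C 2<N 0F last refl 1+last≡N))
    where
    2<N : 2 < N
    2<N = s≤s (s≤s (s≤s z≤n))
    1+last≡N : suc (toℕ last) ≡ N
    1+last≡N = cong suc (toℕ-fromℕ _)
    P : HamPath (v 𝟘) (seq last)
    P = openedPath C 2<N 0F last refl 1+last≡N

  twoHookedCycle : Σ HamCycle TwoHooked
  twoHookedCycle = C , nonAlternating , 𝟘 , inj₁ hookPath

lemma8 : (m : ℕ) {{_ : NonZero m}} → 3 ≤ m → (a b : Fin m) →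
         toℕ a ≢ 0 → 2 * toℕ a ≢ m →
         toℕ b ≢ 0 → 2 * toℕ b ≢ m →
         (a ≡ b ⊎ toℕ a + toℕ b ≡ m) →
         IGraph.Connected m a b →
         Σ (IGraph.HamCycle m a b) (IGraph.TwoHooked m a b)
lemma8 .(3 + n) (s≤s (s≤s (s≤s (z≤n {n})))) a b _ _ _ _ a±b connected =
  HookedCycle.twoHookedCycle n a b a±b connected
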